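{- Let $k$ be an odd positive integer such that $5k+2$ is prime, let $m$ be a positive integer greater than $2$, and let $r\in\mathbb{N}$. Then $$F_{m(5k+r)}\equiv F_{mr}F_{3m-1}+5kF_{mr-1}\left(3^{m-1}+\sum_{i=1}^{m-1}3^{m-1-i}F_{3i-1}\right)\pmod{5k+2}.$$
   Context: $(F_n)_{n\ge 0}$ denotes the Fibonacci sequence: $F_0=0$, $F_1=1$, $F_{n+2}=F_{n+1}+F_n$. $\mathbb{N}$ denotes the natural numbers. -}

module Defs where

open import Data.Nat as ℕ using (ℕ; zero; suc)
open import Data.Integer as ℤ using (ℤ; +_; -[1+_]; _+_; _*_; _-_; -_)

fib : ℕ → ℕ
fib zero = 0
fib (suc zero) = 1
fib (suc (suc n)) = fib (suc n) ℕ.+ fib n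

-- Standard extension to negative indices (needed for F_{mr-1} when r = 0):
-- F_{-n} = (-1)^{n+1} F_n, which is the unique extension satisfying the recurrence.
sign : ℕ → ℤ
sign zero = + 1
sign (suc n) = - sign n

fibℤ : ℤ → ℤ
fibℤ (+ n) = + fib n
fibℤ -[1+ n ] = sign n * + fib (suc n)

sum1to : ℕ → (ℕ → ℤ) → ℤ
sum1to zero f = + 0
sum1to (suc n) f = sum1to n f + f (suc n)

{-# OPTIONS --safe #-}
module Submission where

-- Let p = 5k + 2. As k is odd, p ≡ 7 (mod 10), and Gauss's lemma gives 5^((p − 1)/2) ≡ −1 (mod p).
-- The freshman's dream in ℤ[φ], applied to √5 = 2φ − 1, then shows that the Frobenius map conjugates
-- φ: φ^p ≡ φ̄ = 1 − φ (mod p). As φφ̄ = −1 this gives φ^(5k) ≡ φ̄³, hence φ^(m(5k + r)) ≡ φ̄^(3m) φ^(mr).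
-- Reading off φ-coefficients with φ^n = F_{n−1} + F_n φ and φ̄^n = F_{n+1} − F_n φ yields
-- F_{m(5k+r)} ≡ F_{mr} F_{3m−1} − F_{3m} F_{mr−1}, which is the claim since 5k ≡ −2 and F_{3m} is
-- twice the bracketed sum.

open import Algebra.Bundles using (CommutativeSemiring)
open import Data.Fin as Fin using (Fin; toℕ; fromℕ; inject₁)
import Data.Fin.Properties as Fin
open import Data.Nat as ℕ using (ℕ; zero; suc; _<_; _≤_; s≤s; z≤n; _!)
import Data.Nat.Properties as ℕ
open import Data.Nat.Divisibility using (quotient; m∣n⇒n≡m*quotient; ∣⇒≤; ∣1⇒≡1; m∣m*n) renaming (_∣_ to _∣ℕ_)
open import Data.Nat.Combinatorics using (_C_; nCn≡1; nCk≡n!/k![n-k]!; k![n∸k]!∣n!)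
open import Data.Nat.DivMod using (_%_; _/_; m/n*n≡m; m≡m%n+[m/n]*n)
open import Data.Nat.Primality using (Prime; euclidsLemma; prime⇒nonTrivial)
open import Data.Nat.Properties using (_!*_!≢0)
open import Data.Empty using (⊥-elim)
open import Data.Product using (∃-syntax; _,_)
open import Data.Sum using (inj₁; inj₂)
open import Relation.Nullary using (¬_)
import Relation.Binary.PropositionalEquality as ≡

prime⇒1<p : ∀ {p} → Prime p → 1 < p
prime⇒1<p {p} pr = ℕ.nonTrivial⇒n>1 p {{prime⇒nonTrivial pr}}

prime∤small : ∀ {p n} → Prime p → 0 < n → n < p → ¬ p ∣ℕ n
prime∤small pr 0<n n<p p∣n = ℕ.<⇒≱ n<p (∣⇒≤ {{ℕ.>-nonZero 0<n}} p∣n)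

prime∤factorial : ∀ {p n} → Prime p → n < p → ¬ p ∣ℕ n !
prime∤factorial {n = zero} pr _ p∣1 = ℕ.<⇒≢ (prime⇒1<p pr) (≡.sym (∣1⇒≡1 p∣1))
prime∤factorial {n = suc n} pr n<p p∣n! with euclidsLemma (suc n) (n !) pr p∣n!
... | inj₁ p∣1+n = prime∤small pr (s≤s z≤n) n<p p∣1+n
... | inj₂ p∣n!′ = prime∤factorial pr (ℕ.<-trans (ℕ.n<1+n n) n<p) p∣n!′

prime∣choose : ∀ {p k} → Prime p → 0 < k → k < p → p ∣ℕ p C k
prime∣choose {p} {k} pr 0<k k<p
  with euclidsLemma (p C k) (k ! ℕ.* (p ℕ.∸ k) !) pr (≡.subst (p ∣ℕ_) (≡.sym choose*denominator) (p∣p! p (prime⇒1<p pr)))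
  where
  choose*denominator : (p C k) ℕ.* (k ! ℕ.* (p ℕ.∸ k) !) ≡.≡ p !
  choose*denominator = ≡.trans (≡.cong (ℕ._* (k ! ℕ.* (p ℕ.∸ k) !)) (nCk≡n!/k![n-k]! (ℕ.<⇒≤ k<p)))
                             (m/n*n≡m {{k !* (p ℕ.∸ k) !≢0}} (k![n∸k]!∣n! (ℕ.<⇒≤ k<p)))
  p∣p! : ∀ p → 1 < p → p ∣ℕ p !
  p∣p! (suc q) _ = m∣m*n (q !)
... | inj₁ p∣choose = p∣choose
... | inj₂ p∣denominator with euclidsLemma (k !) ((p ℕ.∸ k) !) pr p∣denominator
...   | inj₁ p∣k! = ⊥-elim (prime∤factorial pr k<p p∣k!)
...   | inj₂ p∣[p∸k]! = ⊥-elim (prime∤factorial pr (ℕ.∸-monoʳ-< 0<k (ℕ.<⇒≤ k<p)) p∣[p∸k]!)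

module FreshmansDream {c ℓ} (S : CommutativeSemiring c ℓ) where
  open CommutativeSemiring S
  open import Algebra.Properties.Semiring.Exp semiring using (_^_)
  open import Algebra.Properties.Semiring.Mult semiring using (_×_; ×-assocˡ; ×-congˡ)
  open import Algebra.Properties.CommutativeMonoid.Mult +-commutativeMonoid using (×-distrib-+)
  open import Algebra.Properties.Monoid.Sum +-monoid using (sum; sum-init-last; sum-cong-≋)
  open import Algebra.Properties.CommutativeSemiring.Binomial S
    using (binomialTerm; theorem)
  open import Relation.Binary.Reasoning.Setoid setoid

  ×-zeroʳ : ∀ m → m × 0# ≈ 0#
  ×-zeroʳ zero = refl
  ×-zeroʳ (suc m) = trans (+-identityˡ (m × 0#)) (×-zeroʳ m)

  sum-× : ∀ m {n} (f : Fin n → Carrier) → sum (λ i → m × f i) ≈ m × sum f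
  sum-× m {zero} f = sym (×-zeroʳ m)
  sum-× m {suc n} f = begin
    m × f Fin.zero + sum (λ i → m × f (Fin.suc i)) ≈⟨ +-congˡ (sum-× m (λ i → f (Fin.suc i))) ⟩
    m × f Fin.zero + m × sum (λ i → f (Fin.suc i)) ≈⟨ ×-distrib-+ _ _ m ⟨
    m × sum f                                        ∎

  freshman's-dream : ∀ {p} → Prime p → ∀ x y → ∃[ z ] (x + y) ^ p ≈ x ^ p + y ^ p + p × z
  freshman's-dream {zero} pr x y = ⊥-elim (ℕ.n≮0 (prime⇒1<p pr))
  freshman's-dream {p@(suc q)} pr x y = sum quotients , (begin
    (x + y) ^ p                                            ≈⟨ theorem p x y ⟩
    first + sum (λ i → binomialTerm x y p (Fin.suc i))     ≈⟨ +-cong first≈y^p (sum-init-last (λ i → binomialTerm x y p (Fin.suc i))) ⟩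
    y ^ p + (sum inner + last)                             ≈⟨ +-congˡ (+-cong inner≈ last≈x^p) ⟩
    y ^ p + (p × sum quotients + x ^ p)                    ≈⟨ rearrange ⟩
    x ^ p + y ^ p + p × sum quotients                      ∎)
    where
    first last : Carrier
    first = binomialTerm x y p Fin.zero
    last = binomialTerm x y p (Fin.suc (fromℕ q))

    inner : Fin q → Carrier
    inner i = binomialTerm x y p (Fin.suc (inject₁ i))

    p∣inner : ∀ (i : Fin q) → p ∣ℕ p C suc (toℕ (inject₁ i))
    p∣inner i = prime∣choose pr (s≤s z≤n)
      (s≤s (≡.subst (_< q) (≡.sym (Fin.toℕ-inject₁ i)) (Fin.toℕ<n i)))

    quotients : Fin q → Carrier
    quotients i = quotient (p∣inner i) × (x ^ suc (toℕ (inject₁ i)) * y ^ (q ℕ.∸ toℕ (inject₁ i)))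

    first≈y^p : first ≈ y ^ p
    first≈y^p = trans (+-identityʳ _) (*-identityˡ _)

    last≈x^p : last ≈ x ^ p
    last≈x^p rewrite Fin.toℕ-fromℕ q | nCn≡1 (suc q) | ℕ.n∸n≡0 q = trans (+-identityʳ _) (*-identityʳ _)

    inner≈ : sum inner ≈ p × sum quotients
    inner≈ = trans (sum-cong-≋ inner≈p×quotient) (sum-× p quotients)
      where
      inner≈p×quotient : ∀ i → inner i ≈ p × quotients i
      inner≈p×quotient i = trans (×-congˡ (m∣n⇒n≡m*quotient (p∣inner i))) (sym (×-assocˡ _ p (quotient (p∣inner i))))

    rearrange : y ^ p + (p × sum quotients + x ^ p) ≈ x ^ p + y ^ p + p × sum quotients
    rearrange = begin
      y ^ p + (p × sum quotients + x ^ p) ≈⟨ +-congˡ (+-comm _ _) ⟩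
      y ^ p + (x ^ p + p × sum quotients) ≈⟨ +-assoc _ _ _ ⟨
      y ^ p + x ^ p + p × sum quotients   ≈⟨ +-congʳ (+-comm _ _) ⟩
      x ^ p + y ^ p + p × sum quotients   ∎

open import Defs
open import Algebra.Structures.Biased using (isCommutativeSemiringˡ; isCommutativeMonoidˡ)
open import Data.Integer as ℤ using (ℤ; +_; _+_; _*_; _-_; -_; _^_)
import Data.Integer.Properties as ℤ
open import Data.Integer.Divisibility using (_∣_)
open import Data.Integer.Divisibility.Signed as Signed using (divides; ∣ᵤ⇒∣; ∣⇒∣ᵤ; ∣m∣n⇒∣m+n; ∣m⇒∣-m; ∣m⇒∣m*n; ∣n⇒∣m*n)
open import Data.Integer.Tactic.RingSolver using (solve-∀)
import Data.Nat.Tactic.RingSolver as ℕ-Solver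
open import Level using (0ℓ)
open import Relation.Binary.Bundles using (Setoid)
open import Relation.Binary.PropositionalEquality
import Relation.Binary.Reasoning.Setoid as SetoidReasoning

-- A record rather than an abbreviation, so that unification does not unfold it into integer
-- arithmetic. Note the space in `[mod n ]`: `n]` would be lexed as a single identifier.
infix 4 _≡_[mod_]
record _≡_[mod_] (a b : ℤ) (n : ℕ) : Set where
  constructor ∣⇒≡-mod
  field ≡-mod⇒∣ : + n Signed.∣ a - b
open _≡_[mod_] public

≡⇒≡-mod : ∀ {a b n} → a ≡ b → a ≡ b [mod n ]
≡⇒≡-mod {a} refl = ∣⇒≡-mod (divides (+ 0) (ℤ.+-inverseʳ a))

≡-mod-sym : ∀ {a b n} → a ≡ b [mod n ] → b ≡ a [mod n ]
≡-mod-sym {a} {b} (∣⇒≡-mod n∣a-b) = ∣⇒≡-mod (subst (_ Signed.∣_) (difference-flip a b) (∣m⇒∣-m n∣a-b))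
  where
  difference-flip : ∀ a b → - (a - b) ≡ b - a
  difference-flip = solve-∀

≡-mod-trans : ∀ {a b c n} → a ≡ b [mod n ] → b ≡ c [mod n ] → a ≡ c [mod n ]
≡-mod-trans {a} {b} {c} (∣⇒≡-mod n∣a-b) (∣⇒≡-mod n∣b-c) =
  ∣⇒≡-mod (subst (_ Signed.∣_) (telescope a b c) (∣m∣n⇒∣m+n n∣a-b n∣b-c))
  where
  telescope : ∀ a b c → (a - b) + (b - c) ≡ a - c
  telescope = solve-∀

+-cong-mod : ∀ {a b c d n} → a ≡ b [mod n ] → c ≡ d [mod n ] → a + c ≡ b + d [mod n ]
+-cong-mod {a} {b} {c} {d} (∣⇒≡-mod n∣a-b) (∣⇒≡-mod n∣c-d) =
  ∣⇒≡-mod (subst (_ Signed.∣_) (regroup a b c d) (∣m∣n⇒∣m+n n∣a-b n∣c-d))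
  where
  regroup : ∀ a b c d → (a - b) + (c - d) ≡ (a + c) - (b + d)
  regroup = solve-∀

*-cong-mod : ∀ {a b c d n} → a ≡ b [mod n ] → c ≡ d [mod n ] → a * c ≡ b * d [mod n ]
*-cong-mod {a} {b} {c} {d} (∣⇒≡-mod n∣a-b) (∣⇒≡-mod n∣c-d) =
  ∣⇒≡-mod (subst (_ Signed.∣_) (regroup a b c d) (∣m∣n⇒∣m+n (∣m⇒∣m*n c n∣a-b) (∣n⇒∣m*n b n∣c-d)))
  where
  regroup : ∀ a b c d → (a - b) * c + b * (c - d) ≡ a * c - b * d
  regroup = solve-∀

+-congˡ-mod : ∀ a {b c n} → b ≡ c [mod n ] → a + b ≡ a + c [mod n ]
+-congˡ-mod a = +-cong-mod (≡⇒≡-mod {a} refl)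

+-congʳ-mod : ∀ c {a b n} → a ≡ b [mod n ] → a + c ≡ b + c [mod n ]
+-congʳ-mod c a≡b = +-cong-mod a≡b (≡⇒≡-mod {c} refl)

*-congˡ-mod : ∀ a {b c n} → b ≡ c [mod n ] → a * b ≡ a * c [mod n ]
*-congˡ-mod a = *-cong-mod (≡⇒≡-mod {a} refl)

*-congʳ-mod : ∀ c {a b n} → a ≡ b [mod n ] → a * c ≡ b * c [mod n ]
*-congʳ-mod c a≡b = *-cong-mod a≡b (≡⇒≡-mod {c} refl)

n*a≡0-mod : ∀ n a → + n * a ≡ + 0 [mod n ]
n*a≡0-mod n a = ∣⇒≡-mod (divides a (trans (ℤ.+-identityʳ (+ n * a)) (ℤ.*-comm (+ n) a)))

≡-mod-setoid : ℕ → Setoid _ _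
≡-mod-setoid n = record
  { Carrier = ℤ
  ; _≈_ = λ a b → a ≡ b [mod n ]
  ; isEquivalence = record
    { refl = λ {a} → ≡⇒≡-mod {a} refl
    ; sym = λ {a} {b} → ≡-mod-sym {a} {b}
    ; trans = λ {a} {b} {c} → ≡-mod-trans {a} {b} {c} } }

module ≡-mod-Reasoning (n : ℕ) = SetoidReasoning (≡-mod-setoid n)

*-cancelʳ-≡-mod : ∀ {p a b} c → Prime p → ¬ p ∣ℕ ℤ.∣ c ∣ → a * c ≡ b * c [mod p ] → a ≡ b [mod p ]
*-cancelʳ-≡-mod {p} {a} {b} c pr p∤c (∣⇒≡-mod p∣ac-bc)
  with euclidsLemma ℤ.∣ a - b ∣ ℤ.∣ c ∣ pr
         (subst (p ∣ℕ_) (ℤ.abs-* (a - b) c) (∣⇒∣ᵤ (subst (_ Signed.∣_) (factor a b c) p∣ac-bc)))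
  where
  factor : ∀ a b c → a * c - b * c ≡ (a - b) * c
  factor = solve-∀
... | inj₁ p∣a-b = ∣⇒≡-mod (∣ᵤ⇒∣ p∣a-b)
... | inj₂ p∣c = ⊥-elim (p∤c p∣c)

infixl 6 _⊕_
infixl 7 _⊗_

-- ⟨ a , b ⟩ stands for a + bφ, where φ² = φ + 1.
record ℤ[φ] : Set where
  constructor ⟨_,_⟩
  field
    c₀ c₁ : ℤ
open ℤ[φ] public

_⊕_ : ℤ[φ] → ℤ[φ] → ℤ[φ]
⟨ a , b ⟩ ⊕ ⟨ c , d ⟩ = ⟨ a + c , b + d ⟩

_⊗_ : ℤ[φ] → ℤ[φ] → ℤ[φ]
⟨ a , b ⟩ ⊗ ⟨ c , d ⟩ = ⟨ a * c + b * d , a * d + b * c + b * d ⟩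

𝟘 𝟙 : ℤ[φ]
𝟘 = ⟨ + 0 , + 0 ⟩
𝟙 = ⟨ + 1 , + 0 ⟩

⊕-assoc : ∀ x y z → (x ⊕ y) ⊕ z ≡ x ⊕ (y ⊕ z)
⊕-assoc ⟨ a , b ⟩ ⟨ c , d ⟩ ⟨ e , f ⟩ = cong₂ ⟨_,_⟩ (ℤ.+-assoc a c e) (ℤ.+-assoc b d f)

⊕-comm : ∀ x y → x ⊕ y ≡ y ⊕ x
⊕-comm ⟨ a , b ⟩ ⟨ c , d ⟩ = cong₂ ⟨_,_⟩ (ℤ.+-comm a c) (ℤ.+-comm b d)

⊕-identityˡ : ∀ x → 𝟘 ⊕ x ≡ x
⊕-identityˡ ⟨ a , b ⟩ = cong₂ ⟨_,_⟩ (ℤ.+-identityˡ a) (ℤ.+-identityˡ b)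

⊗-assoc : ∀ x y z → (x ⊗ y) ⊗ z ≡ x ⊗ (y ⊗ z)
⊗-assoc ⟨ a , b ⟩ ⟨ c , d ⟩ ⟨ e , f ⟩ = cong₂ ⟨_,_⟩ (c₀-law a b c d e f) (c₁-law a b c d e f)
  where
  c₀-law : ∀ a b c d e f → (a * c + b * d) * e + (a * d + b * c + b * d) * f
                         ≡ a * (c * e + d * f) + b * (c * f + d * e + d * f)
  c₀-law = solve-∀
  c₁-law : ∀ a b c d e f → (a * c + b * d) * f + (a * d + b * c + b * d) * e + (a * d + b * c + b * d) * f
                         ≡ a * (c * f + d * e + d * f) + b * (c * e + d * f) + b * (c * f + d * e + d * f)
  c₁-law = solve-∀

⊗-comm : ∀ x y → x ⊗ y ≡ y ⊗ x
⊗-comm ⟨ a , b ⟩ ⟨ c , d ⟩ = cong₂ ⟨_,_⟩ (c₀-law a b c d) (c₁-law a b c d)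
  where
  c₀-law : ∀ a b c d → a * c + b * d ≡ c * a + d * b
  c₀-law = solve-∀
  c₁-law : ∀ a b c d → a * d + b * c + b * d ≡ c * b + d * a + d * b
  c₁-law = solve-∀

⊗-identityˡ : ∀ x → 𝟙 ⊗ x ≡ x
⊗-identityˡ ⟨ a , b ⟩ = cong₂ ⟨_,_⟩ (c₀-law a b) (c₁-law a b)
  where
  c₀-law : ∀ a b → + 1 * a + + 0 * b ≡ a
  c₀-law = solve-∀
  c₁-law : ∀ a b → + 1 * b + + 0 * a + + 0 * b ≡ b
  c₁-law = solve-∀

⊗-zeroˡ : ∀ x → 𝟘 ⊗ x ≡ 𝟘
⊗-zeroˡ ⟨ a , b ⟩ = cong₂ ⟨_,_⟩ (c₀-law a b) (c₁-law a b)
  where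
  c₀-law : ∀ a b → + 0 * a + + 0 * b ≡ + 0
  c₀-law = solve-∀
  c₁-law : ∀ a b → + 0 * b + + 0 * a + + 0 * b ≡ + 0
  c₁-law = solve-∀

⊗-distribʳ-⊕ : ∀ x y z → (y ⊕ z) ⊗ x ≡ y ⊗ x ⊕ z ⊗ x
⊗-distribʳ-⊕ ⟨ a , b ⟩ ⟨ c , d ⟩ ⟨ e , f ⟩ = cong₂ ⟨_,_⟩ (c₀-law a b c d e f) (c₁-law a b c d e f)
  where
  c₀-law : ∀ a b c d e f → (c + e) * a + (d + f) * b ≡ (c * a + d * b) + (e * a + f * b)
  c₀-law = solve-∀
  c₁-law : ∀ a b c d e f → (c + e) * b + (d + f) * a + (d + f) * b ≡ (c * b + d * a + d * b) + (e * b + f * a + f * b)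
  c₁-law = solve-∀

ℤ[φ]-commutativeSemiring : CommutativeSemiring 0ℓ 0ℓ
ℤ[φ]-commutativeSemiring = record
  { Carrier = ℤ[φ]
  ; _≈_ = _≡_
  ; _+_ = _⊕_
  ; _*_ = _⊗_
  ; 0# = 𝟘
  ; 1# = 𝟙
  ; isCommutativeSemiring = isCommutativeSemiringˡ record
    { +-isCommutativeMonoid = commutativeMonoid ⊕-assoc ⊕-identityˡ ⊕-comm
    ; *-isCommutativeMonoid = commutativeMonoid ⊗-assoc ⊗-identityˡ ⊗-comm
    ; distribʳ = ⊗-distribʳ-⊕
    ; zeroˡ = ⊗-zeroˡ } }
  where
  open import Algebra.Definitions {A = ℤ[φ]} _≡_ using (Associative; LeftIdentity; Commutative)
  open import Algebra.Structures {A = ℤ[φ]} _≡_ using (IsCommutativeMonoid)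
  commutativeMonoid : ∀ {_∙_ ε} → Associative _∙_ → LeftIdentity ε _∙_ → Commutative _∙_ → IsCommutativeMonoid _∙_ ε
  commutativeMonoid {_∙_} assoc identityˡ comm = isCommutativeMonoidˡ record
    { isSemigroup = record { isMagma = record { isEquivalence = isEquivalence ; ∙-cong = cong₂ _∙_ } ; assoc = assoc }
    ; identityˡ = identityˡ
    ; comm = comm }

open CommutativeSemiring ℤ[φ]-commutativeSemiring using (semiring; +-identityʳ; *-identityʳ)
open import Algebra.Properties.Semiring.Exp semiring using (^-homo-*; ^-assocʳ) renaming (_^_ to _⊗^_)
open import Algebra.Properties.Semiring.Mult semiring using (_×_)
open import Algebra.Properties.CommutativeSemiring.Exp ℤ[φ]-commutativeSemiring using (^-distrib-*)
open FreshmansDream ℤ[φ]-commutativeSemiring using (freshman's-dream)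

infix 4 _≋_[mod_]
record _≋_[mod_] (x y : ℤ[φ]) (n : ℕ) : Set where
  constructor ≋-mod
  field
    c₀-≡ : c₀ x ≡ c₀ y [mod n ]
    c₁-≡ : c₁ x ≡ c₁ y [mod n ]
open _≋_[mod_] public

≡⇒≋-mod : ∀ {x y n} → x ≡ y → x ≋ y [mod n ]
≡⇒≋-mod refl = ≋-mod (≡⇒≡-mod refl) (≡⇒≡-mod refl)

≋-mod-sym : ∀ {x y n} → x ≋ y [mod n ] → y ≋ x [mod n ]
≋-mod-sym (≋-mod e₀ e₁) = ≋-mod (≡-mod-sym e₀) (≡-mod-sym e₁)

≋-mod-trans : ∀ {x y z n} → x ≋ y [mod n ] → y ≋ z [mod n ] → x ≋ z [mod n ]
≋-mod-trans (≋-mod e₀ e₁) (≋-mod f₀ f₁) = ≋-mod (≡-mod-trans e₀ f₀) (≡-mod-trans e₁ f₁)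

≋-setoid : ℕ → Setoid _ _
≋-setoid n = record
  { Carrier = ℤ[φ]
  ; _≈_ = λ x y → x ≋ y [mod n ]
  ; isEquivalence = record
    { refl = λ {x} → ≡⇒≋-mod {x} refl
    ; sym = λ {x} {y} → ≋-mod-sym {x} {y}
    ; trans = λ {x} {y} {z} → ≋-mod-trans {x} {y} {z} } }

module ≋-Reasoning (n : ℕ) = SetoidReasoning (≋-setoid n)

⊕-cong-mod : ∀ {x y u v n} → x ≋ y [mod n ] → u ≋ v [mod n ] → x ⊕ u ≋ y ⊕ v [mod n ]
⊕-cong-mod (≋-mod e₀ e₁) (≋-mod f₀ f₁) = ≋-mod (+-cong-mod e₀ f₀) (+-cong-mod e₁ f₁)

⊗-cong-mod : ∀ {x y u v n} → x ≋ y [mod n ] → u ≋ v [mod n ] → x ⊗ u ≋ y ⊗ v [mod n ]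
⊗-cong-mod (≋-mod e₀ e₁) (≋-mod f₀ f₁) =
  ≋-mod (+-cong-mod (*-cong-mod e₀ f₀) (*-cong-mod e₁ f₁))
        (+-cong-mod (+-cong-mod (*-cong-mod e₀ f₁) (*-cong-mod e₁ f₀)) (*-cong-mod e₁ f₁))

^-cong-mod : ∀ {x y n} k → x ≋ y [mod n ] → x ⊗^ k ≋ y ⊗^ k [mod n ]
^-cong-mod zero x≋y = ≡⇒≋-mod refl
^-cong-mod (suc k) x≋y = ⊗-cong-mod x≋y (^-cong-mod k x≋y)

×-components : ∀ n x → n × x ≡ ⟨ + n * c₀ x , + n * c₁ x ⟩
×-components zero ⟨ a , b ⟩ = cong₂ ⟨_,_⟩ (sym (ℤ.*-zeroˡ a)) (sym (ℤ.*-zeroˡ b))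
×-components (suc n) ⟨ a , b ⟩ rewrite ×-components n ⟨ a , b ⟩ =
  cong₂ ⟨_,_⟩ (sym (suc-* n a)) (sym (suc-* n b))
  where
  suc-* : ∀ n a → + suc n * a ≡ a + + n * a
  suc-* n a = trans (cong (_* a) (ℤ.pos-+ 1 n)) (distrib (+ n) a)
    where
    distrib : ∀ m a → (+ 1 + m) * a ≡ a + m * a
    distrib = solve-∀

freshman's-dream-mod : ∀ {p} → Prime p → ∀ x y → (x ⊕ y) ⊗^ p ≋ x ⊗^ p ⊕ y ⊗^ p [mod p ]
freshman's-dream-mod {p} pr x y with freshman's-dream pr x y
... | z , expansion = begin
  (x ⊕ y) ⊗^ p                ≡⟨ expansion ⟩
  x ⊗^ p ⊕ y ⊗^ p ⊕ p × z     ≈⟨ ⊕-cong-mod {x ⊗^ p ⊕ y ⊗^ p} (≡⇒≋-mod refl) multiple≋𝟘 ⟩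
  x ⊗^ p ⊕ y ⊗^ p ⊕ 𝟘         ≡⟨ +-identityʳ _ ⟩
  x ⊗^ p ⊕ y ⊗^ p             ∎
  where
  open ≋-Reasoning p
  multiple≋𝟘 : p × z ≋ 𝟘 [mod p ]
  multiple≋𝟘 rewrite ×-components p z = ≋-mod (n*a≡0-mod p (c₀ z)) (n*a≡0-mod p (c₁ z))

φ φ̄ √5 : ℤ[φ]
φ = ⟨ + 0 , + 1 ⟩
φ̄ = ⟨ + 1 , - + 1 ⟩
√5 = ⟨ - + 1 , + 2 ⟩

ι : ℤ → ℤ[φ]
ι a = ⟨ a , + 0 ⟩

ι-⊗ : ∀ a x → ι a ⊗ x ≡ ⟨ a * c₀ x , a * c₁ x ⟩
ι-⊗ a ⟨ c , d ⟩ = cong₂ ⟨_,_⟩ (c₀-law a c d) (c₁-law a c d)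
  where
  c₀-law : ∀ a c d → a * c + + 0 * d ≡ a * c
  c₀-law = solve-∀
  c₁-law : ∀ a c d → a * d + + 0 * c + + 0 * d ≡ a * d
  c₁-law = solve-∀

ι-^ : ∀ a n → ι a ⊗^ n ≡ ι (a ^ n)
ι-^ a zero = refl
ι-^ a (suc n) = trans (cong (ι a ⊗_) (ι-^ a n)) (trans (ι-⊗ a (ι (a ^ n))) (cong ⟨ a * a ^ n ,_⟩ (ℤ.*-zeroʳ a)))

fibℤ-suc-suc : ∀ n → + fib (suc (suc n)) ≡ + fib (suc n) + + fib n
fibℤ-suc-suc n = ℤ.pos-+ (fib (suc n)) (fib n)

φ^suc : ∀ n → φ ⊗^ suc n ≡ ⟨ + fib n , + fib (suc n) ⟩
φ^suc zero = refl
φ^suc (suc n) = trans (cong (φ ⊗_) (φ^suc n))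
  (cong₂ ⟨_,_⟩ (c₀-law (+ fib n) (+ fib (suc n)))
               (trans (c₁-law (+ fib n) (+ fib (suc n))) (sym (fibℤ-suc-suc n))))
  where
  c₀-law : ∀ u v → + 0 * u + + 1 * v ≡ v
  c₀-law = solve-∀
  c₁-law : ∀ u v → + 0 * v + + 1 * u + + 1 * v ≡ v + u
  c₁-law = solve-∀

-- For n = 0 this relies on fibℤ (-1) = 1.
φ^ : ∀ n → φ ⊗^ n ≡ ⟨ fibℤ (+ n - + 1) , fibℤ (+ n) ⟩
φ^ zero = refl
φ^ (suc n) = φ^suc n

φ̄^ : ∀ n → φ̄ ⊗^ n ≡ ⟨ + fib (suc n) , - + fib n ⟩
φ̄^ zero = refl
φ̄^ (suc n) = trans (cong (φ̄ ⊗_) (φ̄^ n))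
  (cong₂ ⟨_,_⟩ (trans (c₀-law (+ fib (suc n)) (+ fib n)) (sym (fibℤ-suc-suc n)))
               (c₁-law (+ fib (suc n)) (+ fib n)))
  where
  c₀-law : ∀ v u → + 1 * v + - + 1 * - u ≡ v + u
  c₀-law = solve-∀
  c₁-law : ∀ v u → + 1 * - u + - + 1 * v + - + 1 * - u ≡ - v
  c₁-law = solve-∀

√5^odd : ∀ h → √5 ⊗^ suc (2 ℕ.* h) ≡ ι ((+ 5) ^ h) ⊗ √5
√5^odd zero = refl
√5^odd (suc h) = begin
  √5 ⊗^ suc (2 ℕ.* suc h)           ≡⟨ cong (λ k → √5 ⊗^ suc k) (ℕ.*-suc 2 h) ⟩
  √5 ⊗ (√5 ⊗ √5 ⊗^ suc (2 ℕ.* h))   ≡⟨ ⊗-assoc √5 √5 (√5 ⊗^ suc (2 ℕ.* h)) ⟨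
  ι (+ 5) ⊗ √5 ⊗^ suc (2 ℕ.* h)     ≡⟨ cong (ι (+ 5) ⊗_) (√5^odd h) ⟩
  ι (+ 5) ⊗ (ι ((+ 5) ^ h) ⊗ √5)      ≡⟨ ⊗-assoc (ι (+ 5)) (ι ((+ 5) ^ h)) √5 ⟨
  ι (+ 5) ⊗ ι ((+ 5) ^ h) ⊗ √5        ≡⟨ cong (_⊗ √5) (ι-⊗ (+ 5) (ι ((+ 5) ^ h))) ⟩
  ι ((+ 5) ^ suc h) ⊗ √5              ∎
  where open ≡-Reasoning

-1^odd : ∀ h → (- + 1) ^ suc (2 ℕ.* h) ≡ - + 1
-1^odd zero = refl
-1^odd (suc h) = begin
  (- + 1) ^ suc (2 ℕ.* suc h)                ≡⟨ cong (λ k → (- + 1) ^ suc k) (ℕ.*-suc 2 h) ⟩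
  (- + 1) ^ (2 ℕ.+ suc (2 ℕ.* h))            ≡⟨ ℤ.^-distribˡ-+-* (- + 1) 2 (suc (2 ℕ.* h)) ⟩
  (- + 1) ^ 2 * (- + 1) ^ suc (2 ℕ.* h)      ≡⟨ cong ((- + 1) ^ 2 *_) (-1^odd h) ⟩
  - + 1                                      ∎
  where open ≡-Reasoning

odd-prime⇒2<p : ∀ h → Prime (suc (2 ℕ.* h)) → 2 < suc (2 ℕ.* h)
odd-prime⇒2<p zero pr = ⊥-elim (ℕ.<-irrefl refl (prime⇒1<p pr))
odd-prime⇒2<p (suc h) _ = s≤s (s≤s (ℕ.≤-trans (s≤s z≤n) (ℕ.m≤n+m _ h)))

2^p≡2 : ∀ {p} → Prime p → (+ 2) ^ p ≡ + 2 [mod p ]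
2^p≡2 {p} pr = begin
  (+ 2) ^ p                  ≡⟨ cong c₀ (ι-^ (+ 2) p) ⟨
  c₀ ((𝟙 ⊕ 𝟙) ⊗^ p)          ≈⟨ c₀-≡ (freshman's-dream-mod pr 𝟙 𝟙) ⟩
  c₀ (𝟙 ⊗^ p ⊕ 𝟙 ⊗^ p)       ≡⟨ cong (λ x → c₀ (x ⊕ x)) (ι-^ (+ 1) p) ⟩
  (+ 1) ^ p + (+ 1) ^ p      ≡⟨ cong (λ a → a + a) (ℤ.^-zeroˡ p) ⟩
  + 2                        ∎
  where open ≡-mod-Reasoning p

√5^p≋-1+2^pφ^p : ∀ h → Prime (suc (2 ℕ.* h)) →
                 √5 ⊗^ suc (2 ℕ.* h) ≋ ι (- + 1) ⊕ ι ((+ 2) ^ suc (2 ℕ.* h)) ⊗ φ ⊗^ suc (2 ℕ.* h) [mod suc (2 ℕ.* h) ]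
√5^p≋-1+2^pφ^p h pr = begin
  √5 ⊗^ p                                ≈⟨ freshman's-dream-mod pr (ι (- + 1)) (ι (+ 2) ⊗ φ) ⟩
  ι (- + 1) ⊗^ p ⊕ (ι (+ 2) ⊗ φ) ⊗^ p   ≡⟨ cong₂ _⊕_ (trans (ι-^ (- + 1) p) (cong ι (-1^odd h)))
                                                     (trans (^-distrib-* (ι (+ 2)) φ p) (cong (_⊗ φ ⊗^ p) (ι-^ (+ 2) p))) ⟩
  ι (- + 1) ⊕ ι ((+ 2) ^ p) ⊗ φ ⊗^ p     ∎
  where
  p = suc (2 ℕ.* h)
  open ≋-Reasoning p

φ^p≋φ̄ : ∀ {p} h → Prime p → p ≡ suc (2 ℕ.* h) → (+ 5) ^ h ≡ - + 1 [mod p ] → φ ⊗^ p ≋ φ̄ [mod p ]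
φ^p≋φ̄ {p} h pr refl 5^h≡-1 =
  ≋-mod-trans (≡⇒≋-mod (φ^suc (2 ℕ.* h))) (≋-mod (cancel-2 F[p-1]*2≡1*2) (cancel-2 F[p]*2≡-1*2))
  where
  open ≡-mod-Reasoning p

  cancel-2 : ∀ {a b} → a * + 2 ≡ b * + 2 [mod p ] → a ≡ b [mod p ]
  cancel-2 = *-cancelʳ-≡-mod (+ 2) pr (prime∤small pr (s≤s z≤n) (odd-prime⇒2<p h pr))

  frobenius : ⟨ (+ 5) ^ h * - + 1 , (+ 5) ^ h * + 2 ⟩
            ≋ ⟨ - + 1 + (+ 2) ^ p * + fib (2 ℕ.* h) , + 0 + (+ 2) ^ p * + fib p ⟩ [mod p ]
  frobenius = subst₂ (λ x y → x ≋ y [mod p ])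
    (trans (√5^odd h) (ι-⊗ ((+ 5) ^ h) √5))
    (cong (ι (- + 1) ⊕_) (trans (cong (ι ((+ 2) ^ p) ⊗_) (φ^suc (2 ℕ.* h))) (ι-⊗ ((+ 2) ^ p) _)))
    (√5^p≋-1+2^pφ^p h pr)

  F[p]*2≡-1*2 : + fib p * + 2 ≡ - + 1 * + 2 [mod p ]
  F[p]*2≡-1*2 = begin
    + fib p * + 2                 ≈⟨ *-congˡ-mod (+ fib p) (≡-mod-sym (2^p≡2 pr)) ⟩
    + fib p * (+ 2) ^ p           ≡⟨ commute (+ fib p) ((+ 2) ^ p) ⟩
    + 0 + (+ 2) ^ p * + fib p     ≈⟨ c₁-≡ frobenius ⟨
    (+ 5) ^ h * + 2               ≈⟨ *-congʳ-mod (+ 2) 5^h≡-1 ⟩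
    - + 1 * + 2                   ∎
    where
    commute : ∀ u t → u * t ≡ + 0 + t * u
    commute = solve-∀

  F[p-1]*2≡1*2 : + fib (2 ℕ.* h) * + 2 ≡ + 1 * + 2 [mod p ]
  F[p-1]*2≡1*2 = begin
    + fib (2 ℕ.* h) * + 2                      ≈⟨ *-congˡ-mod (+ fib (2 ℕ.* h)) (≡-mod-sym (2^p≡2 pr)) ⟩
    + fib (2 ℕ.* h) * (+ 2) ^ p                ≡⟨ isolate (+ fib (2 ℕ.* h)) ((+ 2) ^ p) ⟩
    - + 1 + (+ 2) ^ p * + fib (2 ℕ.* h) - - + 1  ≈⟨ +-congʳ-mod (- - + 1) (c₀-≡ frobenius) ⟨
    (+ 5) ^ h * - + 1 - - + 1                  ≈⟨ +-congʳ-mod (- - + 1) (*-congʳ-mod (- + 1) 5^h≡-1) ⟩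
    + 1 * + 2                                  ∎
    where
    isolate : ∀ u t → u * t ≡ - + 1 + t * u - - + 1
    isolate = solve-∀

∏ : ℕ → (ℕ → ℤ) → ℤ
∏ zero f = + 1
∏ (suc n) f = ∏ n f * f n

syntax ∏ n (λ i → e) = ∏[ i < n ] e

∏-cong : ∀ n {f g} → (∀ i → f i ≡ g i) → ∏ n f ≡ ∏ n g
∏-cong zero f≗g = refl
∏-cong (suc n) f≗g = cong₂ _*_ (∏-cong n f≗g) (f≗g n)

∏-cong-mod : ∀ n {f g m} → (∀ i → f i ≡ g i [mod m ]) → ∏ n f ≡ ∏ n g [mod m ]
∏-cong-mod zero f≗g = ≡⇒≡-mod refl
∏-cong-mod (suc n) f≗g = *-cong-mod (∏-cong-mod n f≗g) (f≗g n)

∏-+ : ∀ m n f → ∏ (m ℕ.+ n) f ≡ ∏ m f * ∏[ i < n ] f (m ℕ.+ i)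
∏-+ m zero f = trans (cong (λ k → ∏ k f) (ℕ.+-identityʳ m)) (sym (ℤ.*-identityʳ (∏ m f)))
∏-+ m (suc n) f = begin
  ∏ (m ℕ.+ suc n) f                                    ≡⟨ cong (λ k → ∏ k f) (ℕ.+-suc m n) ⟩
  ∏ (m ℕ.+ n) f * f (m ℕ.+ n)                          ≡⟨ cong (_* f (m ℕ.+ n)) (∏-+ m n f) ⟩
  ∏ m f * ∏[ i < n ] f (m ℕ.+ i) * f (m ℕ.+ n)         ≡⟨ ℤ.*-assoc (∏ m f) _ _ ⟩
  ∏ m f * ∏[ i < suc n ] f (m ℕ.+ i)                   ∎
  where open ≡-Reasoning

∏-cons : ∀ n f → ∏ (suc n) f ≡ f 0 * ∏[ i < n ] f (suc i)
∏-cons zero f = trans (ℤ.*-identityˡ (f 0)) (sym (ℤ.*-identityʳ (f 0)))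
∏-cons (suc n) f = trans (cong (_* f (suc n)) (∏-cons n f)) (ℤ.*-assoc (f 0) _ _)

∏-* : ∀ n f g → ∏[ i < n ] (f i * g i) ≡ ∏ n f * ∏ n g
∏-* zero f g = refl
∏-* (suc n) f g = trans (cong (_* (f n * g n)) (∏-* n f g)) (interchange (∏ n f) (∏ n g) (f n) (g n))
  where
  interchange : ∀ a b c d → a * b * (c * d) ≡ a * c * (b * d)
  interchange = solve-∀

∏-const : ∀ n c → ∏[ i < n ] c ≡ c ^ n
∏-const zero c = refl
∏-const (suc n) c = trans (cong (_* c) (∏-const n c)) (ℤ.*-comm (c ^ n) c)

∏-neg : ∀ n f → ∏[ i < n ] (- f i) ≡ (- + 1) ^ n * ∏ n f
∏-neg n f = begin
  ∏[ i < n ] (- f i)            ≡⟨ ∏-cong n (λ i → ℤ.-1*i≡-i (f i)) ⟨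
  ∏[ i < n ] (- + 1 * f i)      ≡⟨ ∏-* n (λ _ → - + 1) f ⟩
  ∏[ i < n ] (- + 1) * ∏ n f    ≡⟨ cong (_* ∏ n f) (∏-const n (- + 1)) ⟩
  (- + 1) ^ n * ∏ n f           ∎
  where open ≡-Reasoning

∏-reverse-mod : ∀ n {f g m} → (∀ i j → suc (i ℕ.+ j) ≡ n → f i ≡ g j [mod m ]) → ∏ n f ≡ ∏ n g [mod m ]
∏-reverse-mod zero _ = ≡⇒≡-mod refl
∏-reverse-mod (suc n) {f} {g} {m} paired = begin
  ∏ n f * f n                       ≈⟨ *-cong-mod (∏-reverse-mod n inner) (paired n 0 (cong suc (ℕ.+-identityʳ n))) ⟩
  ∏[ j < n ] g (suc j) * g 0        ≡⟨ ℤ.*-comm _ (g 0) ⟩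
  g 0 * ∏[ j < n ] g (suc j)        ≡⟨ ∏-cons n g ⟨
  ∏ (suc n) g                       ∎
  where
  open ≡-mod-Reasoning m
  inner : ∀ i j → suc (i ℕ.+ j) ≡ n → f i ≡ g (suc j) [mod m ]
  inner i j i+j+1≡n = paired i (suc j) (cong suc (trans (ℕ.+-suc i j) i+j+1≡n))

∏-factorial : ∀ n → ∏[ i < n ] (+ suc i) ≡ + (n !)
∏-factorial zero = refl
∏-factorial (suc n) = begin
  ∏[ i < n ] (+ suc i) * + suc n  ≡⟨ cong (_* + suc n) (∏-factorial n) ⟩
  + (n !) * + suc n             ≡⟨ ℤ.pos-* (n !) (suc n) ⟨
  + (n ! ℕ.* suc n)             ≡⟨ cong +_ (ℕ.*-comm (n !) (suc n)) ⟩
  + (suc n !)                   ∎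
  where open ≡-Reasoning

a≡b+cn⇒a≡b-mod : ∀ {a b} c {n} → a ≡ b ℕ.+ c ℕ.* n → + a ≡ + b [mod n ]
a≡b+cn⇒a≡b-mod {a} {b} c {n} refl = ∣⇒≡-mod (divides (+ c) (begin
  + (b ℕ.+ c ℕ.* n) - + b      ≡⟨ cong (_- + b) (trans (ℤ.pos-+ b (c ℕ.* n)) (cong (λ y → + b + y) (ℤ.pos-* c n))) ⟩
  + b + + c * + n - + b        ≡⟨ cancel (+ b) (+ c * + n) ⟩
  + c * + n                    ∎))
  where
  open ≡-Reasoning
  cancel : ∀ x y → x + y - x ≡ y
  cancel = solve-∀

a+b≡cn⇒a≡-b-mod : ∀ {a b} c {n} → a ℕ.+ b ≡ c ℕ.* n → + a ≡ - + b [mod n ]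
a+b≡cn⇒a≡-b-mod {a} {b} c {n} a+b≡cn = ∣⇒≡-mod (divides (+ c) (begin
  + a - - + b          ≡⟨ double-negation (+ a) (+ b) ⟩
  + a + + b            ≡⟨ ℤ.pos-+ a b ⟨
  + (a ℕ.+ b)          ≡⟨ cong +_ a+b≡cn ⟩
  + (c ℕ.* n)          ≡⟨ ℤ.pos-* c n ⟩
  + c * + n            ∎))
  where
  open ≡-Reasoning
  double-negation : ∀ x y → x - - y ≡ x + y
  double-negation = solve-∀

∏-class : ℕ → ℕ → ℤ
∏-class c n = ∏[ j < n ] (+ (c ℕ.+ j ℕ.* 5))

∏-by-classes : ∀ t → ∏[ i < 3 ℕ.+ t ℕ.* 5 ] (+ suc i)
             ≡ ∏-class 1 (suc t) * ∏-class 2 (suc t) * ∏-class 3 (suc t) * ∏-class 4 t * ∏-class 5 t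
∏-by-classes zero = refl
∏-by-classes (suc t) =
  trans (cong (λ P → P * x 4 * x 5 * x 6 * x 7 * x 8) (∏-by-classes t))
        (regroup (∏-class 1 (suc t)) (∏-class 2 (suc t)) (∏-class 3 (suc t)) (∏-class 4 t) (∏-class 5 t)
                 (x 4) (x 5) (x 6) (x 7) (x 8))
  where
  x : ℕ → ℤ
  x c = + (c ℕ.+ t ℕ.* 5)
  regroup : ∀ a₁ a₂ a₃ a₄ a₅ x₄ x₅ x₆ x₇ x₈ →
    a₁ * a₂ * a₃ * a₄ * a₅ * x₄ * x₅ * x₆ * x₇ * x₈ ≡ a₁ * x₆ * (a₂ * x₇) * (a₃ * x₈) * (a₄ * x₄) * (a₅ * x₅)
  regroup = solve-∀

-1^n*-1^n≡1 : ∀ n → (- + 1) ^ n * (- + 1) ^ n ≡ + 1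
-1^n*-1^n≡1 zero = refl
-1^n*-1^n≡1 (suc n) = trans (square-neg ((- + 1) ^ n)) (-1^n*-1^n≡1 n)
  where
  square-neg : ∀ s → - + 1 * s * (- + 1 * s) ≡ s * s
  square-neg = solve-∀

∏-multiples : ∀ n c → ∏[ i < n ] (+ (suc i ℕ.* c)) ≡ (+ c) ^ n * + (n !)
∏-multiples n c = begin
  ∏[ i < n ] (+ (suc i ℕ.* c))              ≡⟨ ∏-cong n (λ i → ℤ.pos-* (suc i) c) ⟩
  ∏[ i < n ] (+ suc i * + c)                ≡⟨ ∏-* n (λ i → + suc i) (λ _ → + c) ⟩
  ∏[ i < n ] (+ suc i) * ∏[ i < n ] (+ c)   ≡⟨ cong₂ _*_ (∏-factorial n) (∏-const n (+ c)) ⟩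
  + (n !) * (+ c) ^ n                       ≡⟨ ℤ.*-comm (+ (n !)) _ ⟩
  (+ c) ^ n * + (n !)                       ∎
  where open ≡-Reasoning

-- Gauss's lemma for 5 and p = 10t + 7, h = (p − 1)/2: reducing 5, 10, …, 5h into (−p/2, p/2) hits each of
-- ±1, …, ±h once, with 2t + 1 minus signs, so 5^h h! ≡ −h!. The multiples 5i fall into five blocks
-- of consecutive i, according to which of the residue classes 0, −2, 3, −4, 1 (mod 5) they land in.
module GaussLemma (t : ℕ) where

  p h : ℕ
  p = 7 ℕ.+ t ℕ.* 10
  h = 3 ℕ.+ t ℕ.* 5

  f : ℕ → ℤ
  f i = + (suc i ℕ.* 5)

  g₂ g₃ g₄ g₅ : ℕ → ℤ
  g₂ i = f (t ℕ.+ i)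
  g₃ i = f (t ℕ.+ (suc t ℕ.+ i))
  g₄ i = f (t ℕ.+ (suc t ℕ.+ (suc t ℕ.+ i)))
  g₅ i = f (t ℕ.+ (suc t ℕ.+ (suc t ℕ.+ (t ℕ.+ i))))

  ∏f≡blocks : ∏ h f ≡ ∏ t f * (∏ (suc t) g₂ * (∏ (suc t) g₃ * (∏ t g₄ * ∏ (suc t) g₅)))
  ∏f≡blocks = trans (cong (λ n → ∏ n f) (h≡block-sizes t))
    (trans (∏-+ t _ f) (cong (∏ t f *_)
    (trans (∏-+ (suc t) _ g₂) (cong (∏ (suc t) g₂ *_)
    (trans (∏-+ (suc t) _ g₃) (cong (∏ (suc t) g₃ *_) (∏-+ t _ g₄)))))))
    where
    h≡block-sizes : ∀ t → 3 ℕ.+ t ℕ.* 5 ≡ t ℕ.+ (suc t ℕ.+ (suc t ℕ.+ (t ℕ.+ suc t)))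
    h≡block-sizes = ℕ-Solver.solve-∀

  block₂ : ∏ (suc t) g₂ ≡ (- + 1) ^ suc t * ∏-class 2 (suc t) [mod p ]
  block₂ = ≡-mod-trans (∏-reverse-mod (suc t) residue) (≡⇒≡-mod (∏-neg (suc t) (λ j → + (2 ℕ.+ j ℕ.* 5))))
    where
    sum≡p : ∀ i j → suc (i ℕ.+ j ℕ.+ i) ℕ.* 5 ℕ.+ (2 ℕ.+ j ℕ.* 5) ≡ 1 ℕ.* (7 ℕ.+ (i ℕ.+ j) ℕ.* 10)
    sum≡p = ℕ-Solver.solve-∀
    residue : ∀ i j → suc (i ℕ.+ j) ≡ suc t → g₂ i ≡ - + (2 ℕ.+ j ℕ.* 5) [mod p ]
    residue i j i+j+1≡t+1 =
      subst (λ t → + (suc (t ℕ.+ i) ℕ.* 5) ≡ - + (2 ℕ.+ j ℕ.* 5) [mod 7 ℕ.+ t ℕ.* 10 ])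
            (ℕ.suc-injective i+j+1≡t+1) (a+b≡cn⇒a≡-b-mod 1 (sum≡p i j))

  block₃ : ∏ (suc t) g₃ ≡ ∏-class 3 (suc t) [mod p ]
  block₃ = ∏-cong-mod (suc t) (λ i → a≡b+cn⇒a≡b-mod 1 (difference≡p i t))
    where
    difference≡p : ∀ i t → suc (t ℕ.+ (suc t ℕ.+ i)) ℕ.* 5 ≡ (3 ℕ.+ i ℕ.* 5) ℕ.+ 1 ℕ.* (7 ℕ.+ t ℕ.* 10)
    difference≡p = ℕ-Solver.solve-∀

  block₄ : ∏ t g₄ ≡ (- + 1) ^ t * ∏-class 4 t [mod p ]
  block₄ = ≡-mod-trans (∏-reverse-mod t residue) (≡⇒≡-mod (∏-neg t (λ j → + (4 ℕ.+ j ℕ.* 5))))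
    where
    sum≡2p : ∀ i j → suc (suc (i ℕ.+ j) ℕ.+ (suc (suc (i ℕ.+ j)) ℕ.+ (suc (suc (i ℕ.+ j)) ℕ.+ i))) ℕ.* 5 ℕ.+ (4 ℕ.+ j ℕ.* 5)
                   ≡ 2 ℕ.* (7 ℕ.+ suc (i ℕ.+ j) ℕ.* 10)
    sum≡2p = ℕ-Solver.solve-∀
    residue : ∀ i j → suc (i ℕ.+ j) ≡ t → g₄ i ≡ - + (4 ℕ.+ j ℕ.* 5) [mod p ]
    residue i j i+j+1≡t =
      subst (λ t → + (suc (t ℕ.+ (suc t ℕ.+ (suc t ℕ.+ i))) ℕ.* 5) ≡ - + (4 ℕ.+ j ℕ.* 5) [mod 7 ℕ.+ t ℕ.* 10 ])
            i+j+1≡t (a+b≡cn⇒a≡-b-mod 2 (sum≡2p i j))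

  block₅ : ∏ (suc t) g₅ ≡ ∏-class 1 (suc t) [mod p ]
  block₅ = ∏-cong-mod (suc t) (λ i → a≡b+cn⇒a≡b-mod 2 (difference≡2p i t))
    where
    difference≡2p : ∀ i t → suc (t ℕ.+ (suc t ℕ.+ (suc t ℕ.+ (t ℕ.+ i)))) ℕ.* 5 ≡ (1 ℕ.+ i ℕ.* 5) ℕ.+ 2 ℕ.* (7 ℕ.+ t ℕ.* 10)
    difference≡2p = ℕ-Solver.solve-∀

  ∏f≡-h! : ∏ h f ≡ - + 1 * + (h !) [mod p ]
  ∏f≡-h! = begin
    ∏ h f                                                       ≡⟨ ∏f≡blocks ⟩
    ∏ t f * (∏ (suc t) g₂ * (∏ (suc t) g₃ * (∏ t g₄ * ∏ (suc t) g₅)))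
      ≈⟨ *-congˡ-mod (∏ t f) (*-cong-mod block₂ (*-cong-mod block₃ (*-cong-mod block₄ block₅))) ⟩
    a₅ * ((- + 1) ^ suc t * a₂ * (a₃ * ((- + 1) ^ t * a₄ * a₁)))   ≡⟨ regroup ((- + 1) ^ t) a₁ a₂ a₃ a₄ a₅ ⟩
    - ((- + 1) ^ t * (- + 1) ^ t) * (a₁ * a₂ * a₃ * a₄ * a₅)      ≡⟨ cong (λ u → - u * (a₁ * a₂ * a₃ * a₄ * a₅)) (-1^n*-1^n≡1 t) ⟩
    - + 1 * (a₁ * a₂ * a₃ * a₄ * a₅)                             ≡⟨ cong (- + 1 *_) (trans (sym (∏-by-classes t)) (∏-factorial h)) ⟩
    - + 1 * + (h !)                                              ∎
    where
    open ≡-mod-Reasoning p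
    a₁ a₂ a₃ a₄ a₅ : ℤ
    a₁ = ∏-class 1 (suc t)
    a₂ = ∏-class 2 (suc t)
    a₃ = ∏-class 3 (suc t)
    a₄ = ∏-class 4 t
    a₅ = ∏-class 5 t
    regroup : ∀ s a₁ a₂ a₃ a₄ a₅ → a₅ * (- + 1 * s * a₂ * (a₃ * (s * a₄ * a₁))) ≡ - (s * s) * (a₁ * a₂ * a₃ * a₄ * a₅)
    regroup = solve-∀

  5^h≡-1 : Prime p → (+ 5) ^ h ≡ - + 1 [mod p ]
  5^h≡-1 pr = *-cancelʳ-≡-mod (+ (h !)) pr (prime∤factorial pr h<p)
    (≡-mod-trans (≡⇒≡-mod (sym (∏-multiples h 5))) ∏f≡-h!)
    where
    h<p : h < p
    h<p = ℕ.+-mono-≤ {4} {7} (s≤s (s≤s (s≤s (s≤s z≤n)))) (ℕ.*-monoʳ-≤ t {5} {10} (ℕ.m≤m+n 5 5))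

sum1to-cong : ∀ n {f g : ℕ → ℤ} → (∀ i → i ≤ n → f i ≡ g i) → sum1to n f ≡ sum1to n g
sum1to-cong zero f≗g = refl
sum1to-cong (suc n) f≗g = cong₂ _+_ (sum1to-cong n (λ i i≤n → f≗g i (ℕ.m≤n⇒m≤1+n i≤n))) (f≗g (suc n) ℕ.≤-refl)

sum1to-*ˡ : ∀ n c f → sum1to n (λ i → c * f i) ≡ c * sum1to n f
sum1to-*ˡ zero c f = sym (ℤ.*-zeroʳ c)
sum1to-*ˡ (suc n) c f = trans (cong (_+ c * f (suc n)) (sum1to-*ˡ n c f)) (sym (ℤ.*-distribˡ-+ c (sum1to n f) (f (suc n))))

S : ℕ → ℤ
S n = (+ 3) ^ n + sum1to n (λ i → (+ 3) ^ (n ℕ.∸ i) * fibℤ (+ (3 ℕ.* i ℕ.∸ 1)))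

S-suc : ∀ n → S (suc n) ≡ + 3 * S n + + fib (3 ℕ.* suc n ℕ.∸ 1)
S-suc n = begin
  (+ 3) ^ suc n + (sum1to n (λ i → (+ 3) ^ (suc n ℕ.∸ i) * F[3i-1] i) + (+ 3) ^ (n ℕ.∸ n) * F[3i-1] (suc n))
    ≡⟨ cong₂ (λ x y → (+ 3) ^ suc n + (x + y)) inner last ⟩
  + 3 * (+ 3) ^ n + (+ 3 * sum1to n (λ i → (+ 3) ^ (n ℕ.∸ i) * F[3i-1] i) + F[3i-1] (suc n))
    ≡⟨ factor (+ 3) ((+ 3) ^ n) _ (F[3i-1] (suc n)) ⟩
  + 3 * S n + + fib (3 ℕ.* suc n ℕ.∸ 1) ∎
  where
  open ≡-Reasoning
  F[3i-1] : ℕ → ℤ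
  F[3i-1] i = fibℤ (+ (3 ℕ.* i ℕ.∸ 1))
  inner : sum1to n (λ i → (+ 3) ^ (suc n ℕ.∸ i) * F[3i-1] i) ≡ + 3 * sum1to n (λ i → (+ 3) ^ (n ℕ.∸ i) * F[3i-1] i)
  inner = trans (sum1to-cong n (λ i i≤n → trans (cong (λ e → (+ 3) ^ e * F[3i-1] i) (ℕ.+-∸-assoc 1 i≤n))
                                                  (ℤ.*-assoc (+ 3) ((+ 3) ^ (n ℕ.∸ i)) (F[3i-1] i))))
                (sum1to-*ˡ n (+ 3) (λ i → (+ 3) ^ (n ℕ.∸ i) * F[3i-1] i))
  last : (+ 3) ^ (n ℕ.∸ n) * F[3i-1] (suc n) ≡ F[3i-1] (suc n)
  last = trans (cong (λ e → (+ 3) ^ e * F[3i-1] (suc n)) (ℕ.n∸n≡0 n)) (ℤ.*-identityˡ _)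
  factor : ∀ c x y z → c * x + (c * y + z) ≡ c * (x + y) + z
  factor = solve-∀

fib-suc⁴ : ∀ d → + fib (suc (suc (suc (suc d)))) ≡ + 3 * + fib (suc d) + + 2 * + fib d
fib-suc⁴ d = begin
  + fib (suc (suc (suc (suc d))))   ≡⟨ fibℤ-suc-suc (suc (suc d)) ⟩
  + fib (suc (suc (suc d))) + + fib (suc (suc d))
    ≡⟨ cong₂ _+_ (trans (fibℤ-suc-suc (suc d)) (cong (_+ + fib (suc d)) (fibℤ-suc-suc d))) (fibℤ-suc-suc d) ⟩
  + fib (suc d) + + fib d + + fib (suc d) + (+ fib (suc d) + + fib d)
    ≡⟨ collect (+ fib (suc d)) (+ fib d) ⟩
  + 3 * + fib (suc d) + + 2 * + fib d ∎
  where
  open ≡-Reasoning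
  collect : ∀ a b → a + b + a + (a + b) ≡ + 3 * a + + 2 * b
  collect = solve-∀

fib[3[n+1]]≡2*S : ∀ n → + fib (3 ℕ.* suc n) ≡ + 2 * S n
fib[3[n+1]]≡2*S zero = refl
fib[3[n+1]]≡2*S (suc n) = begin
  + fib (3 ℕ.* suc (suc n))                              ≡⟨ cong (λ e → + fib e) (ℕ.*-suc 3 (suc n)) ⟩
  + fib (suc (suc (suc (3 ℕ.* suc n))))                  ≡⟨ fib-suc⁴ (3 ℕ.* suc n ℕ.∸ 1) ⟩
  + 3 * + fib (3 ℕ.* suc n) + + 2 * + fib (3 ℕ.* suc n ℕ.∸ 1)
    ≡⟨ cong (λ x → + 3 * x + + 2 * + fib (3 ℕ.* suc n ℕ.∸ 1)) (fib[3[n+1]]≡2*S n) ⟩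
  + 3 * (+ 2 * S n) + + 2 * + fib (3 ℕ.* suc n ℕ.∸ 1)   ≡⟨ factor (S n) _ ⟩
  + 2 * (+ 3 * S n + + fib (3 ℕ.* suc n ℕ.∸ 1))          ≡⟨ cong (+ 2 *_) (S-suc n) ⟨
  + 2 * S (suc n)                                        ∎
  where
  open ≡-Reasoning
  factor : ∀ s f → + 3 * (+ 2 * s) + + 2 * f ≡ + 2 * (+ 3 * s + f)
  factor = solve-∀

-- φ φ̄ = −1, so φ² φ̄² = 1.
φ^[n+2]≋φ̄⇒φ^n≋φ̄^3 : ∀ {n m} → φ ⊗^ (n ℕ.+ 2) ≋ φ̄ [mod m ] → φ ⊗^ n ≋ φ̄ ⊗^ 3 [mod m ]
φ^[n+2]≋φ̄⇒φ^n≋φ̄^3 {n} {m} φ^[n+2]≋φ̄ = begin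
  φ ⊗^ n                                ≡⟨ *-identityʳ (φ ⊗^ n) ⟨
  φ ⊗^ n ⊗ (φ ⊗^ 2 ⊗ φ̄ ⊗^ 2)            ≡⟨ ⊗-assoc (φ ⊗^ n) (φ ⊗^ 2) (φ̄ ⊗^ 2) ⟨
  φ ⊗^ n ⊗ φ ⊗^ 2 ⊗ φ̄ ⊗^ 2              ≡⟨ cong (_⊗ φ̄ ⊗^ 2) (^-homo-* φ n 2) ⟨
  φ ⊗^ (n ℕ.+ 2) ⊗ φ̄ ⊗^ 2               ≈⟨ ⊗-cong-mod φ^[n+2]≋φ̄ (≡⇒≋-mod refl) ⟩
  φ̄ ⊗^ 3                                ∎
  where open ≋-Reasoning m

φ^[m[N+r]]≋φ̄^[jm]⊗φ^[mr] : ∀ {N j n} → φ ⊗^ N ≋ φ̄ ⊗^ j [mod n ] → ∀ m r →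
              φ ⊗^ (m ℕ.* (N ℕ.+ r)) ≋ φ̄ ⊗^ (j ℕ.* m) ⊗ φ ⊗^ (m ℕ.* r) [mod n ]
φ^[m[N+r]]≋φ̄^[jm]⊗φ^[mr] {N} {j} {n} φ^N≋φ̄^j m r = begin
  φ ⊗^ (m ℕ.* (N ℕ.+ r))                ≡⟨ cong (φ ⊗^_) (ℕ.*-distribˡ-+ m N r) ⟩
  φ ⊗^ (m ℕ.* N ℕ.+ m ℕ.* r)            ≡⟨ ^-homo-* φ (m ℕ.* N) (m ℕ.* r) ⟩
  φ ⊗^ (m ℕ.* N) ⊗ φ ⊗^ (m ℕ.* r)       ≡⟨ cong (λ e → φ ⊗^ e ⊗ φ ⊗^ (m ℕ.* r)) (ℕ.*-comm m N) ⟩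
  φ ⊗^ (N ℕ.* m) ⊗ φ ⊗^ (m ℕ.* r)       ≡⟨ cong (_⊗ φ ⊗^ (m ℕ.* r)) (^-assocʳ φ N m) ⟨
  (φ ⊗^ N) ⊗^ m ⊗ φ ⊗^ (m ℕ.* r)        ≈⟨ ⊗-cong-mod (^-cong-mod m φ^N≋φ̄^j) (≡⇒≋-mod refl) ⟩
  (φ̄ ⊗^ j) ⊗^ m ⊗ φ ⊗^ (m ℕ.* r)        ≡⟨ cong (_⊗ φ ⊗^ (m ℕ.* r)) (^-assocʳ φ̄ j m) ⟩
  φ̄ ⊗^ (j ℕ.* m) ⊗ φ ⊗^ (m ℕ.* r)       ∎
  where open ≋-Reasoning n

c₁[φ̄^j⊗φ^l] : ∀ j l → c₁ (φ̄ ⊗^ j ⊗ φ ⊗^ l)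
                    ≡ fibℤ (+ l) * (+ fib (suc j) - + fib j) - + fib j * fibℤ (+ l - + 1)
c₁[φ̄^j⊗φ^l] j l rewrite φ̄^ j | φ^ l = expand (+ fib (suc j)) (+ fib j) (fibℤ (+ l - + 1)) (fibℤ (+ l))
  where
  expand : ∀ u v b a → u * a + - v * b + - v * a ≡ a * (u - v) - v * b
  expand = solve-∀

fib-pred : ∀ i → + fib (suc (suc i)) - + fib (suc i) ≡ + fib i
fib-pred i = trans (cong (_- + fib (suc i)) (fibℤ-suc-suc i)) (cancel (+ fib (suc i)) (+ fib i))
  where
  cancel : ∀ x y → x + y - x ≡ y
  cancel = solve-∀

φ^5k≋φ̄^3 : ∀ k → k % 2 ≡ 1 → Prime (5 ℕ.* k ℕ.+ 2) → φ ⊗^ (5 ℕ.* k) ≋ φ̄ ⊗^ 3 [mod 5 ℕ.* k ℕ.+ 2 ]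
φ^5k≋φ̄^3 k k%2≡1 pr = φ^[n+2]≋φ̄⇒φ^n≋φ̄^3 {5 ℕ.* k} (φ^p≋φ̄ h pr p≡1+2h 5^h≡-1)
  where
  t = k / 2
  open GaussLemma t using (h)

  p≡7+t*10 : 5 ℕ.* k ℕ.+ 2 ≡ 7 ℕ.+ t ℕ.* 10
  p≡7+t*10 = trans (cong (λ k → 5 ℕ.* k ℕ.+ 2) k≡1+t*2) (expand t)
    where
    k≡1+t*2 : k ≡ 1 ℕ.+ t ℕ.* 2
    k≡1+t*2 = trans (m≡m%n+[m/n]*n k 2) (cong (ℕ._+ t ℕ.* 2) k%2≡1)
    expand : ∀ t → 5 ℕ.* (1 ℕ.+ t ℕ.* 2) ℕ.+ 2 ≡ 7 ℕ.+ t ℕ.* 10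
    expand = ℕ-Solver.solve-∀

  p≡1+2h : 5 ℕ.* k ℕ.+ 2 ≡ suc (2 ℕ.* h)
  p≡1+2h = trans p≡7+t*10 (expand t)
    where
    expand : ∀ t → 7 ℕ.+ t ℕ.* 10 ≡ suc (2 ℕ.* (3 ℕ.+ t ℕ.* 5))
    expand = ℕ-Solver.solve-∀

  5^h≡-1 : (+ 5) ^ h ≡ - + 1 [mod 5 ℕ.* k ℕ.+ 2 ]
  5^h≡-1 = subst (λ q → (+ 5) ^ h ≡ - + 1 [mod q ]) (sym p≡7+t*10) (GaussLemma.5^h≡-1 t (subst Prime p≡7+t*10 pr))

theorem3p7 : (k m r : ℕ) → 0 < k → k % 2 ≡ 1 → Prime (5 ℕ.* k ℕ.+ 2) → 2 < m →
    (+ (5 ℕ.* k ℕ.+ 2)) ∣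
      (fibℤ (+ (m ℕ.* (5 ℕ.* k ℕ.+ r)))
        - (fibℤ (+ (m ℕ.* r)) * fibℤ (+ (3 ℕ.* m ℕ.∸ 1))
           + (+ 5) * (+ k) * fibℤ (+ (m ℕ.* r) - + 1)
             * ((+ 3) ^ (m ℕ.∸ 1)
                + sum1to (m ℕ.∸ 1) (λ i → (+ 3) ^ (m ℕ.∸ 1 ℕ.∸ i) * fibℤ (+ (3 ℕ.* i ℕ.∸ 1))))))
theorem3p7 k zero r _ _ _ ()
theorem3p7 k m@(suc n) r _ k%2≡1 pr _ = ∣⇒∣ᵤ (≡-mod⇒∣ (begin
  fibℤ (+ (m ℕ.* (5 ℕ.* k ℕ.+ r)))              ≡⟨ cong c₁ (φ^ (m ℕ.* (5 ℕ.* k ℕ.+ r))) ⟨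
  c₁ (φ ⊗^ (m ℕ.* (5 ℕ.* k ℕ.+ r)))
    ≈⟨ c₁-≡ (φ^[m[N+r]]≋φ̄^[jm]⊗φ^[mr] {5 ℕ.* k} {3} (φ^5k≋φ̄^3 k k%2≡1 pr) m r) ⟩
  c₁ (φ̄ ⊗^ (3 ℕ.* m) ⊗ φ ⊗^ (m ℕ.* r))          ≡⟨ c₁[φ̄^j⊗φ^l] (3 ℕ.* m) (m ℕ.* r) ⟩
  a * (+ fib (suc (3 ℕ.* m)) - + fib (3 ℕ.* m)) - + fib (3 ℕ.* m) * b
    ≡⟨ cong₂ (λ x y → a * x - y * b) (fib-pred (3 ℕ.* m ℕ.∸ 1)) (fib[3[n+1]]≡2*S n) ⟩
  a * W - + 2 * S n * b                          ≡⟨ rearrange a W (S n) b ⟩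
  a * W + - + 2 * b * S n                        ≈⟨ +-congˡ-mod (a * W) (*-congʳ-mod (S n) (*-congʳ-mod b 5k≡-2)) ⟨
  a * W + + 5 * + k * b * S n                    ∎))
  where
  open ≡-mod-Reasoning (5 ℕ.* k ℕ.+ 2)

  a b W : ℤ
  a = fibℤ (+ (m ℕ.* r))
  b = fibℤ (+ (m ℕ.* r) - + 1)
  W = fibℤ (+ (3 ℕ.* m ℕ.∸ 1))

  5k≡-2 : + 5 * + k ≡ - + 2 [mod 5 ℕ.* k ℕ.+ 2 ]
  5k≡-2 = subst (λ x → x ≡ - + 2 [mod 5 ℕ.* k ℕ.+ 2 ]) (ℤ.pos-* 5 k) (a+b≡cn⇒a≡-b-mod 1 (sym (ℕ.*-identityˡ _)))

  rearrange : ∀ a W S b → a * W - + 2 * S * b ≡ a * W + - + 2 * b * S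
  rearrange = solve-∀
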